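{- Let $Q_d$ be the $d$-dimensional hypercube, with $P=2^d$ vertices. Let $\tau$ be the time of a one-way communication graph consisting, for each vertex $v$, of a task graph containing a directed path from $v$ to every vertex other than $v$ and the unique vertex at distance $d$ from $v$. Then $\tau\ge \frac{2(P-2)}{d}$.
   Context: $Q_d$ has vertex set $\{0,1\}^d$, with $u,v$ adjacent iff they differ in exactly one coordinate; every edge is present in both directions. A task graph is a finite sequence $(e_i)$ of directed edges labeled by positive integer times $t(e_i)$ such that (i) $t(e_i)<t(e_j)$ implies $e_i<e_j$ or $e_i,e_j$ incomparable, and (ii) $t(e_i)=t(e_j)$ implies $i=j$ or $e_i,e_j$ incomparable, where $e_i<e_j$ means there is a directed path in the task graph beginning with $e_i$ and ending with $e_j$; its time is its maximum label. A one-way communication graph is a collection of task graphs in which no two edge occurrences joining the same two vertices (in either direction) carry the same label; its time is the maximum time of its task graphs. -}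

module Defs where

open import Data.Bool using (Bool; true; false)
open import Data.Nat using (ℕ; zero; suc; _+_; _<_; _≤_; _⊔_)
open import Data.Vec using (Vec; []; _∷_)
open import Data.List using (List; [_]; _++_; map; foldr; length; lookup)
open import Data.Fin using (Fin; toℕ)
open import Data.Product using (_×_; _,_; proj₁; proj₂)
open import Data.Sum using (_⊎_)
open import Relation.Nullary using (¬_)
open import Relation.Binary.PropositionalEquality using (_≡_; _≢_)
open import Relation.Binary.Construct.Closure.Transitive using (TransClosure)

Vertex : ℕ → Set
Vertex d = Vec Bool d

hamming : ∀ {d} → Vertex d → Vertex d → ℕ
hamming [] [] = 0
hamming (true ∷ u) (true ∷ v) = hamming u v
hamming (false ∷ u) (false ∷ v) = hamming u v
hamming (true ∷ u) (false ∷ v) = suc (hamming u v)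
hamming (false ∷ u) (true ∷ v) = suc (hamming u v)

Adjacent : ∀ {d} → Vertex d → Vertex d → Set
Adjacent u v = hamming u v ≡ 1

record DEdge (d : ℕ) : Set where
  constructor dedge
  field
    src : Vertex d
    tgt : Vertex d
    adj : Adjacent src tgt
open DEdge public

LabelledSeq : ℕ → Set
LabelledSeq d = List (DEdge d × ℕ)

module _ {d : ℕ} (g : LabelledSeq d) where

  Idx : Set
  Idx = Fin (length g)

  edgeAt : Idx → DEdge d
  edgeAt i = proj₁ (lookup g i)

  label : Idx → ℕ
  label i = proj₂ (lookup g i)

  Follows : Idx → Idx → Set
  Follows i j = tgt (edgeAt i) ≡ src (edgeAt j)

  Prec : Idx → Idx → Set
  Prec = TransClosure Follows

  Incomparable : Idx → Idx → Set
  Incomparable i j = ¬ Prec i j × ¬ Prec j i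

  IsTaskGraph : Set
  IsTaskGraph =
    (∀ i → 1 ≤ label i)
    × (∀ i j → label i < label j → Prec i j ⊎ Incomparable i j)
    × (∀ i j → label i ≡ label j → i ≡ j ⊎ Incomparable i j)

  time : ℕ
  time = foldr (λ p m → proj₂ p ⊔ m) 0 g

  data Reaches : Vertex d → Vertex d → Set where
    edge : ∀ {v w} (i : Idx) → src (edgeAt i) ≡ v → tgt (edgeAt i) ≡ w → Reaches v w
    step : ∀ {v w} (i : Idx) → src (edgeAt i) ≡ v → Reaches (tgt (edgeAt i)) w → Reaches v w

allVertices : ∀ d → List (Vertex d)
allVertices zero = [ [] ]
allVertices (suc d) = map (true ∷_) (allVertices d) ++ map (false ∷_) (allVertices d)

SameEnds : ∀ {d} → DEdge d → DEdge d → Set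
SameEnds e f = (src e ≡ src f × tgt e ≡ tgt f) ⊎ (src e ≡ tgt f × tgt e ≡ src f)

IsOneWayCommGraph : ∀ {d} → (Vertex d → LabelledSeq d) → Set
IsOneWayCommGraph {d} T =
  (∀ v → IsTaskGraph (T v))
  × (∀ v w (i : Idx (T v)) (j : Idx (T w)) →
       SameEnds (edgeAt (T v) i) (edgeAt (T w) j) →
       label (T v) i ≡ label (T w) j →
       v ≡ w × toℕ i ≡ toℕ j)

commTime : ∀ {d} → (Vertex d → LabelledSeq d) → ℕ
commTime {d} T = foldr (λ v m → time (T v) ⊔ m) 0 (allVertices d)

-- Every vertex v must reach the 2^d - 2 vertices other than itself and its
-- antipode, and a path of T v ending at w ends with an edge occurrence of T v
-- entering w; so the task graphs contain 2^d (2^d - 2) distinct edge occurrences.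
-- The one-way condition puts distinct occurrences (across all task graphs) into
-- distinct pairs (undirected edge, label), of which there are d 2^(d-1) τ.
module Submission where

open import Defs
open import Data.Bool using (Bool; true; false; not)
open import Data.Empty using (⊥-elim)
open import Data.Fin using (Fin; zero; toℕ; fromℕ<; _↑ˡ_; _↑ʳ_; splitAt; punchIn; punchOut)
open import Data.Fin.Properties
  using (2↔Bool; *↔×; splitAt-↑ˡ; splitAt-↑ʳ; toℕ-fromℕ<; toℕ-injective;
         punchIn-injective; punchInᵢ≢i; punchIn-punchOut; injective⇒≤)
open import Data.List using (List; []; _∷_; foldr; map)
open import Data.List.Membership.Propositional using (_∈_)
open import Data.List.Membership.Propositional.Properties using (∈-map⁺; ∈-++⁺ˡ; ∈-++⁺ʳ; ∈-lookup)
open import Data.List.Relation.Unary.Any using (here; there)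
open import Data.Nat using (ℕ; zero; suc; _+_; _*_; _^_; _∸_; _≤_; _⊔_; z≤n; s≤s; NonZero)
open import Data.Nat.Properties
open import Data.Product using (Σ; _×_; _,_; proj₁; proj₂; uncurry)
import Data.Product as Product
open import Data.Product.Function.NonDependent.Propositional using (_×-↔_)
open import Data.Sum using (_⊎_; inj₁; inj₂)
open import Data.Vec using ([]; _∷_; uncons)
import Data.Vec as Vec
open import Function using (_∘_)
open import Function.Bundles using (Inverse; _↔_; Injection; _↣_; mk↔ₛ′; mk↣)
open import Function.Construct.Composition using (_↔-∘_; _↣-∘_)
open import Function.Properties.Inverse using (↔-sym; ↔⇒↣)
open import Relation.Binary.PropositionalEquality

×-↣⇒≤ : ∀ {m n p q} → (Fin m × Fin n) ↣ (Fin p × Fin q) → m * n ≤ p * q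
×-↣⇒≤ f = injective⇒≤ (Injection.injective (↔⇒↣ (↔-sym *↔×) ↣-∘ (f ↣-∘ ↔⇒↣ *↔×)))

↔-from-injective : ∀ {A B : Set} (e : A ↔ B) {x y : B} → Inverse.from e x ≡ Inverse.from e y → x ≡ y
↔-from-injective e = Injection.injective (↔⇒↣ (↔-sym e))

module _ {n : ℕ} {i j : Fin (suc (suc n))} (i≢j : i ≢ j) where

  punchIn₂ : Fin n → Fin (suc (suc n))
  punchIn₂ = punchIn i ∘ punchIn (punchOut i≢j)

  punchIn₂-injective : ∀ a b → punchIn₂ a ≡ punchIn₂ b → a ≡ b
  punchIn₂-injective a b = punchIn-injective _ a b ∘ punchIn-injective i _ _

  punchIn₂≢ˡ : ∀ a → punchIn₂ a ≢ i
  punchIn₂≢ˡ a = punchInᵢ≢i i _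

  punchIn₂≢ʳ : ∀ a → punchIn₂ a ≢ j
  punchIn₂≢ʳ a eq = punchInᵢ≢i (punchOut i≢j) a
    (punchIn-injective i _ _ (trans eq (sym (punchIn-punchOut i≢j))))

foldr-⊔-upper : ∀ {A : Set} (f : A → ℕ) {x : A} {xs : List A} →
                x ∈ xs → f x ≤ foldr (λ y m → f y ⊔ m) 0 xs
foldr-⊔-upper f {xs = y ∷ _} (here refl) = m≤m⊔n (f y) _
foldr-⊔-upper f {xs = y ∷ _} (there x∈xs) = m≤n⇒m≤o⊔n (f y) (foldr-⊔-upper f x∈xs)

vertexIndex : ∀ d → Vertex d ↔ Fin (2 ^ d)
vertexIndex zero = mk↔ₛ′ (λ _ → zero) (λ _ → []) (λ { zero → refl }) (λ { [] → refl })
vertexIndex (suc d) = ↔-sym *↔× ↔-∘ ((↔-sym 2↔Bool ×-↔ vertexIndex d) ↔-∘ headTail)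
  where
  headTail : Vertex (suc d) ↔ (Bool × Vertex d)
  headTail = mk↔ₛ′ uncons (uncurry _∷_) (λ _ → refl) (λ { (_ ∷ _) → refl })

∈-allVertices : ∀ {d} (v : Vertex d) → v ∈ allVertices d
∈-allVertices [] = here refl
∈-allVertices {suc d} (true ∷ v) = ∈-++⁺ˡ (∈-map⁺ (true ∷_) (∈-allVertices v))
∈-allVertices {suc d} (false ∷ v) =
  ∈-++⁺ʳ (map (true ∷_) (allVertices d)) (∈-map⁺ (false ∷_) (∈-allVertices v))

antipode : ∀ {d} → Vertex d → Vertex d
antipode = Vec.map not

antipode-≢ : ∀ {d} → 1 ≤ d → (v : Vertex d) → antipode v ≢ v
antipode-≢ () []
antipode-≢ _ (true ∷ _) ()
antipode-≢ _ (false ∷ _) ()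

hamming≤dim : ∀ {d} (u v : Vertex d) → hamming u v ≤ d
hamming≤dim [] [] = z≤n
hamming≤dim (true ∷ u) (true ∷ v) = m≤n⇒m≤1+n (hamming≤dim u v)
hamming≤dim (false ∷ u) (false ∷ v) = m≤n⇒m≤1+n (hamming≤dim u v)
hamming≤dim (true ∷ u) (false ∷ v) = s≤s (hamming≤dim u v)
hamming≤dim (false ∷ u) (true ∷ v) = s≤s (hamming≤dim u v)

hamming≡0⇒≡ : ∀ {d} (u v : Vertex d) → hamming u v ≡ 0 → u ≡ v
hamming≡0⇒≡ [] [] _ = refl
hamming≡0⇒≡ (true ∷ u) (true ∷ v) eq = cong (true ∷_) (hamming≡0⇒≡ u v eq)
hamming≡0⇒≡ (false ∷ u) (false ∷ v) eq = cong (false ∷_) (hamming≡0⇒≡ u v eq)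

hamming≡dim⇒antipode : ∀ {d} (u v : Vertex d) → hamming u v ≡ d → v ≡ antipode u
hamming≡dim⇒antipode [] [] _ = refl
hamming≡dim⇒antipode {suc d} (true ∷ u) (true ∷ v) eq =
  ⊥-elim (1+n≰n (subst (_≤ d) eq (hamming≤dim u v)))
hamming≡dim⇒antipode {suc d} (false ∷ u) (false ∷ v) eq =
  ⊥-elim (1+n≰n (subst (_≤ d) eq (hamming≤dim u v)))
hamming≡dim⇒antipode (true ∷ u) (false ∷ v) eq =
  cong (false ∷_) (hamming≡dim⇒antipode u v (suc-injective eq))
hamming≡dim⇒antipode (false ∷ u) (true ∷ v) eq =
  cong (true ∷_) (hamming≡dim⇒antipode u v (suc-injective eq))

_≐_ : ∀ {d} → Vertex d × Vertex d → Vertex d × Vertex d → Set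
(s , t) ≐ (s′ , t′) = (s ≡ s′ × t ≡ t′) ⊎ (s ≡ t′ × t ≡ s′)

≐-sym : ∀ {d} {p q : Vertex d × Vertex d} → p ≐ q → q ≐ p
≐-sym (inj₁ (refl , refl)) = inj₁ (refl , refl)
≐-sym (inj₂ (refl , refl)) = inj₂ (refl , refl)

≐-trans : ∀ {d} {p q r : Vertex d × Vertex d} → p ≐ q → q ≐ r → p ≐ r
≐-trans (inj₁ (refl , refl)) q≐r = q≐r
≐-trans (inj₂ (refl , refl)) (inj₁ (refl , refl)) = inj₂ (refl , refl)
≐-trans (inj₂ (refl , refl)) (inj₂ (refl , refl)) = inj₁ (refl , refl)

≐-cons : ∀ {d} (b : Bool) {s t s′ t′ : Vertex d} →
         (s , t) ≐ (s′ , t′) → (b ∷ s , b ∷ t) ≐ (b ∷ s′ , b ∷ t′)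
≐-cons b (inj₁ (refl , refl)) = inj₁ (refl , refl)
≐-cons b (inj₂ (refl , refl)) = inj₂ (refl , refl)

-- The edges of Q_{d+1} are numbered as: the 2^d edges along the first
-- coordinate, then the edges inside the half with first bit true, then
-- those inside the half with first bit false.
edgeCount : ℕ → ℕ
edgeCount zero = 0
edgeCount (suc d) = 2 ^ d + (edgeCount d + edgeCount d)

2*edgeCount : ∀ d → 2 * edgeCount d ≡ d * 2 ^ d
2*edgeCount zero = refl
2*edgeCount (suc d) = begin
  2 * (2 ^ d + (edgeCount d + edgeCount d)) ≡⟨ distribute (2 ^ d) (edgeCount d) ⟩
  2 * 2 ^ d + 2 * (2 * edgeCount d)         ≡⟨ cong (λ x → 2 * 2 ^ d + 2 * x) (2*edgeCount d) ⟩
  2 * 2 ^ d + 2 * (d * 2 ^ d)               ≡⟨ collect (2 ^ d) d ⟩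
  suc d * (2 * 2 ^ d)                       ∎
  where
  open ≡-Reasoning
  open import Data.Nat.Solver using (module +-*-Solver)
  open +-*-Solver
  distribute : ∀ x e → 2 * (x + (e + e)) ≡ 2 * x + 2 * (2 * e)
  distribute = solve 2 (λ x e → con 2 :* (x :+ (e :+ e)) := con 2 :* x :+ con 2 :* (con 2 :* e)) refl
  collect : ∀ x d → 2 * x + 2 * (d * x) ≡ suc d * (2 * x)
  collect = solve 2 (λ x d → con 2 :* x :+ con 2 :* (d :* x) := (con 1 :+ d) :* (con 2 :* x)) refl

edgeCode : ∀ {d} (u v : Vertex d) → Adjacent u v → Fin (edgeCount d)
edgeCode [] [] ()
edgeCode {suc d} (true ∷ u) (false ∷ _) _ = Inverse.to (vertexIndex d) u ↑ˡ _
edgeCode {suc d} (false ∷ u) (true ∷ _) _ = Inverse.to (vertexIndex d) u ↑ˡ _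
edgeCode {suc d} (true ∷ u) (true ∷ v) adj = 2 ^ d ↑ʳ (edgeCode u v adj ↑ˡ edgeCount d)
edgeCode {suc d} (false ∷ u) (false ∷ v) adj = 2 ^ d ↑ʳ (edgeCount d ↑ʳ edgeCode u v adj)

edgeEnds : ∀ {d} → Fin (edgeCount d) → Vertex d × Vertex d
edgeEnds {suc d} i with splitAt (2 ^ d) i
... | inj₁ a = true ∷ Inverse.from (vertexIndex d) a , false ∷ Inverse.from (vertexIndex d) a
... | inj₂ j with splitAt (edgeCount d) j
...   | inj₁ e = Product.map (true ∷_) (true ∷_) (edgeEnds e)
...   | inj₂ e = Product.map (false ∷_) (false ∷_) (edgeEnds e)

edgeEnds-edgeCode : ∀ {d} (u v : Vertex d) (adj : Adjacent u v) → edgeEnds (edgeCode u v adj) ≐ (u , v)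
edgeEnds-edgeCode [] [] ()
edgeEnds-edgeCode {suc d} (true ∷ u) (false ∷ v) adj
  rewrite splitAt-↑ˡ (2 ^ d) (Inverse.to (vertexIndex d) u) (edgeCount d + edgeCount d)
        | Inverse.strictlyInverseʳ (vertexIndex d) u
        | hamming≡0⇒≡ u v (suc-injective adj) = inj₁ (refl , refl)
edgeEnds-edgeCode {suc d} (false ∷ u) (true ∷ v) adj
  rewrite splitAt-↑ˡ (2 ^ d) (Inverse.to (vertexIndex d) u) (edgeCount d + edgeCount d)
        | Inverse.strictlyInverseʳ (vertexIndex d) u
        | hamming≡0⇒≡ u v (suc-injective adj) = inj₂ (refl , refl)
edgeEnds-edgeCode {suc d} (true ∷ u) (true ∷ v) adj
  rewrite splitAt-↑ʳ (2 ^ d) (edgeCount d + edgeCount d) (edgeCode u v adj ↑ˡ edgeCount d)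
        | splitAt-↑ˡ (edgeCount d) (edgeCode u v adj) (edgeCount d) =
  ≐-cons true (edgeEnds-edgeCode u v adj)
edgeEnds-edgeCode {suc d} (false ∷ u) (false ∷ v) adj
  rewrite splitAt-↑ʳ (2 ^ d) (edgeCount d + edgeCount d) (edgeCount d ↑ʳ edgeCode u v adj)
        | splitAt-↑ʳ (edgeCount d) (edgeCount d) (edgeCode u v adj) =
  ≐-cons false (edgeEnds-edgeCode u v adj)

edgeCode-injective : ∀ {d} {u v u′ v′ : Vertex d} (adj : Adjacent u v) (adj′ : Adjacent u′ v′) →
                     edgeCode u v adj ≡ edgeCode u′ v′ adj′ → (u , v) ≐ (u′ , v′)
edgeCode-injective {u = u} {v} {u′} {v′} adj adj′ eq =
  ≐-trans (≐-sym (edgeEnds-edgeCode u v adj))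
          (subst (_≐ (u′ , v′)) (cong edgeEnds (sym eq)) (edgeEnds-edgeCode u′ v′ adj′))

label≤time : ∀ {d} (g : LabelledSeq d) (i : Idx g) → label g i ≤ time g
label≤time g i = foldr-⊔-upper proj₂ (∈-lookup {xs = g} i)

time≤commTime : ∀ {d} (T : Vertex d → LabelledSeq d) (v : Vertex d) → time (T v) ≤ commTime T
time≤commTime T v = foldr-⊔-upper (λ u → time (T u)) (∈-allVertices v)

reaches⇒edgeInto : ∀ {d} {g : LabelledSeq d} {v w : Vertex d} →
                   Reaches g v w → Σ (Idx g) λ i → tgt (edgeAt g i) ≡ w
reaches⇒edgeInto (edge i _ tgt≡w) = i , tgt≡w
reaches⇒edgeInto (step _ _ r) = reaches⇒edgeInto r

-- Labels run from 1, so label ℓ ≤ t occupies slot ℓ - 1 of Fin t.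
labelSlot : ∀ {ℓ t} → 1 ≤ ℓ → ℓ ≤ t → Fin t
labelSlot {suc ℓ} _ ℓ<t = fromℕ< ℓ<t

labelSlot-injective : ∀ {ℓ ℓ′ t} (p : 1 ≤ ℓ) (q : ℓ ≤ t) (p′ : 1 ≤ ℓ′) (q′ : ℓ′ ≤ t) →
                      labelSlot p q ≡ labelSlot p′ q′ → ℓ ≡ ℓ′
labelSlot-injective {suc ℓ} {suc ℓ′} _ q _ q′ eq =
  cong suc (trans (sym (toℕ-fromℕ< q)) (trans (cong toℕ eq) (toℕ-fromℕ< q′)))

module OneWayCommGraph {d : ℕ} {T : Vertex d → LabelledSeq d} (oneWay : IsOneWayCommGraph T) where

  slot : (v : Vertex d) → Idx (T v) → Fin (edgeCount d) × Fin (commTime T)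
  slot v i = edgeCode (src e) (tgt e) (adj e) , labelSlot 1≤label label≤commTime
    where
    e = edgeAt (T v) i
    1≤label : 1 ≤ label (T v) i
    1≤label = proj₁ (proj₁ oneWay v) i
    label≤commTime : label (T v) i ≤ commTime T
    label≤commTime = ≤-trans (label≤time (T v) i) (time≤commTime T v)

  slot-injective : ∀ {v v′} (i : Idx (T v)) (i′ : Idx (T v′)) →
                   slot v i ≡ slot v′ i′ → v ≡ v′ × toℕ i ≡ toℕ i′
  slot-injective i i′ eq =
    proj₂ oneWay _ _ i i′ (edgeCode-injective _ _ (cong proj₁ eq))
                          (labelSlot-injective _ _ _ _ (cong proj₂ eq))

  module _ (reaches : ∀ v w → w ≢ v → hamming v w ≢ d → Reaches (T v) v w) where

    deliveries≤slots : ∀ {k} → 1 ≤ d → 2 ^ d ≡ 2 + k → (2 + k) * k ≤ edgeCount d * commTime T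
    deliveries≤slots {k} 1≤d 2^d≡2+k = ×-↣⇒≤ (mk↣ {to = delivery} delivery-injective)
      where
      index : Vertex d ↔ Fin (2 + k)
      index = subst (λ n → Vertex d ↔ Fin n) 2^d≡2+k (vertexIndex d)
      open Inverse index

      ≢antipode : ∀ a → a ≢ to (antipode (from a))
      ≢antipode a eq = antipode-≢ 1≤d (from a) (sym (trans (cong from eq) (strictlyInverseʳ _)))

      target : Fin (2 + k) → Fin k → Vertex d
      target a b = from (punchIn₂ (≢antipode a) b)

      target≢source : ∀ a b → target a b ≢ from a
      target≢source a b eq = punchIn₂≢ˡ (≢antipode a) b (↔-from-injective index eq)

      target-not-antipodal : ∀ a b → hamming (from a) (target a b) ≢ d
      target-not-antipodal a b eq = punchIn₂≢ʳ (≢antipode a) b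
        (trans (sym (strictlyInverseˡ _)) (cong to (hamming≡dim⇒antipode _ _ eq)))

      lastEdge : ∀ a b → Σ (Idx (T (from a))) λ i → tgt (edgeAt (T (from a)) i) ≡ target a b
      lastEdge a b = reaches⇒edgeInto (reaches _ _ (target≢source a b) (target-not-antipodal a b))

      delivery : Fin (2 + k) × Fin k → Fin (edgeCount d) × Fin (commTime T)
      delivery (a , b) = slot (from a) (proj₁ (lastEdge a b))

      same-target : ∀ {a a′} b b′ → a ≡ a′ →
                    toℕ (proj₁ (lastEdge a b)) ≡ toℕ (proj₁ (lastEdge a′ b′)) → b ≡ b′
      same-target {a} b b′ refl eq =
        punchIn₂-injective (≢antipode a) b b′ (↔-from-injective index (begin
          target a b                                        ≡⟨ sym (proj₂ (lastEdge a b)) ⟩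
          tgt (edgeAt (T (from a)) (proj₁ (lastEdge a b)))  ≡⟨ cong (tgt ∘ edgeAt (T (from a))) (toℕ-injective eq) ⟩
          tgt (edgeAt (T (from a)) (proj₁ (lastEdge a b′))) ≡⟨ proj₂ (lastEdge a b′) ⟩
          target a b′                                       ∎))
        where open ≡-Reasoning

      delivery-injective : ∀ {x y} → delivery x ≡ delivery y → x ≡ y
      delivery-injective {a , b} {a′ , b′} eq with slot-injective _ _ eq
      ... | from≡ , index≡ = cong₂ _,_ a≡a′ (same-target b b′ a≡a′ index≡)
        where a≡a′ = ↔-from-injective index from≡

pk≤et⇒2k≤dt : ∀ p k e t d .{{_ : NonZero p}} → p * k ≤ e * t → 2 * e ≡ d * p → 2 * k ≤ d * t
pk≤et⇒2k≤dt p k e t d pk≤et 2e≡dp = *-cancelˡ-≤ p (begin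
  p * (2 * k)  ≡⟨ swap₁ p k ⟩
  2 * (p * k)  ≤⟨ *-monoʳ-≤ 2 pk≤et ⟩
  2 * (e * t)  ≡⟨ sym (*-assoc 2 e t) ⟩
  2 * e * t    ≡⟨ cong (_* t) 2e≡dp ⟩
  d * p * t    ≡⟨ swap₂ d p t ⟩
  p * (d * t)  ∎)
  where
  open ≤-Reasoning
  open import Data.Nat.Solver using (module +-*-Solver)
  open +-*-Solver
  swap₁ : ∀ p k → p * (2 * k) ≡ 2 * (p * k)
  swap₁ = solve 2 (λ p k → p :* (con 2 :* k) := con 2 :* (p :* k)) refl
  swap₂ : ∀ d p t → d * p * t ≡ p * (d * t)
  swap₂ = solve 3 (λ d p t → d :* p :* t := p :* (d :* t)) refl

theorem3p3 : (d : ℕ) → 1 ≤ d → (T : Vertex d → LabelledSeq d) →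
    IsOneWayCommGraph T →
    (∀ v w → w ≢ v → hamming v w ≢ d → Reaches (T v) v w) →
    2 * (2 ^ d ∸ 2) ≤ d * commTime T
theorem3p3 d 1≤d T oneWay reaches =
  pk≤et⇒2k≤dt (2 + k) k (edgeCount d) (commTime T) d deliveries≤slots 2*edgeCount≡d*[2+k]
  where
  k : ℕ
  k = 2 ^ d ∸ 2
  2^d≡2+k : 2 ^ d ≡ 2 + k
  2^d≡2+k = sym (m+[n∸m]≡n (^-monoʳ-≤ 2 1≤d))
  deliveries≤slots : (2 + k) * k ≤ edgeCount d * commTime T
  deliveries≤slots = OneWayCommGraph.deliveries≤slots oneWay reaches 1≤d 2^d≡2+k
  2*edgeCount≡d*[2+k] : 2 * edgeCount d ≡ d * (2 + k)
  2*edgeCount≡d*[2+k] = trans (2*edgeCount d) (cong (d *_) 2^d≡2+k)
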